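{- Let $T$ be a finite tree, $D$ a distribution on $T$ and $\omega$ a nonnegative integer function on $V(T)$. Then $D$ is not $\omega$-solvable if and only if $\widehat{C}(v)<0$ for every $v\in V(T)$.
   Context: A distribution assigns nonnegative integers (pebbles) to vertices; a pebbling move removes two pebbles from a vertex and adds one to an adjacent vertex; $D$ is $\omega$-solvable if pebbling moves reach $D^*$ with $D^*(v)\ge\omega(v)$ for all $v$. Let $C=D-\omega$ (an integer-valued function). For a leaf $v$ of a tree with neighbor $u$ and integer function $C$, the induced function on the tree minus $v$ is $C'$ with $C'(x)=C(x)$ for $x\ne u$, $C'(u)=C(u)+\lfloor C(v)/2\rfloor$ if $C(v)\ge0$ and $C'(u)=C(u)+2C(v)$ if $C(v)<0$. For a subtree $T^*$ of $T$, the induced generalized distribution on $T^*$ is obtained from $C$ by repeatedly deleting leaves not in $T^*$ and applying this rule. $\widehat{C}(v)$ denotes the value at $v$ of the induced generalized distribution on the one-vertex subtree $\{v\}$. -}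

module Defs where

open import Data.Nat as ℕ using (ℕ; _≤_; _/_)
open import Data.Integer as ℤ using (ℤ; +_; -[1+_]; _<_)
open import Data.Fin using (Fin; _≟_)
open import Data.Bool using (Bool; true; false; T)
open import Data.List using (List; []; _∷_; _++_)
open import Data.List.Relation.Unary.Linked using (Linked)
open import Data.List.Relation.Unary.Unique.Propositional using (Unique)
open import Data.Product using (Σ; ∃; ∃-syntax; _×_; _,_)
open import Relation.Binary.PropositionalEquality using (_≡_; _≢_)
open import Relation.Binary.Construct.Closure.ReflexiveTransitive using (Star)
open import Relation.Nullary using (¬_; yes; no)

record Graph : Set₁ where
  field
    n      : ℕ
    Adj    : Fin n → Fin n → Set
    sym    : ∀ {u v} → Adj u v → Adj v u
    irrefl : ∀ {u} → ¬ Adj u u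

open Graph public

HasCycle : (G : Graph) → Set
HasCycle G = ∃[ x ] ∃[ z ] ∃[ zs ] ∃[ y ]
  ( Unique (x ∷ z ∷ zs ++ y ∷ [])
  × Linked (Adj G) (x ∷ z ∷ zs ++ y ∷ [])
  × Adj G y x )

Connected : (G : Graph) → Set
Connected G = ∀ u v → Star (Adj G) u v

record IsTree (G : Graph) : Set where
  field
    nonempty  : 1 ≤ n G
    connected : Connected G
    acyclic   : ¬ HasCycle G

Distribution : Graph → Set
Distribution G = Fin (n G) → ℕ

PebblingMove : (G : Graph) → Distribution G → Distribution G → Set
PebblingMove G D D' = ∃[ u ] ∃[ v ]
  ( Adj G u v × 2 ≤ D u
  × (D' u ℕ.+ 2 ≡ D u)
  × (D' v ≡ D v ℕ.+ 1)
  × (∀ x → x ≢ u → x ≢ v → D' x ≡ D x) )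

Reachable : (G : Graph) → Distribution G → Distribution G → Set
Reachable G = Star (PebblingMove G)

Solvable : (G : Graph) → (ω : Fin (n G) → ℕ) → Distribution G → Set
Solvable G ω D = ∃[ D* ] (Reachable G D D* × (∀ v → ω v ≤ D* v))

-- contribution of a deleted leaf with value c to its neighbour:
-- ⌊c/2⌋ if c ≥ 0, and 2c if c < 0
passOn : ℤ → ℤ
passOn (+ k)      = + (k / 2)
passOn (-[1+ k ]) = -[1+ k ] ℤ.+ -[1+ k ]

diffFun : (G : Graph) → Distribution G → (Fin (n G) → ℕ) → Fin (n G) → ℤ
diffFun G D ω x = (+ D x) ℤ.- (+ ω x)

-- A state of the leaf-deletion process: current vertex set (a subtree)
-- and the current integer function on it.
State : Graph → Set
State G = (Fin (n G) → Bool) × (Fin (n G) → ℤ)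

IsLeafWith : (G : Graph) → (Fin (n G) → Bool) → Fin (n G) → Fin (n G) → Set
IsLeafWith G S v u =
  T (S v) × T (S u) × Adj G v u × (∀ w → T (S w) → Adj G v w → w ≡ u)

remove : ∀ {m} → (Fin m → Bool) → Fin m → Fin m → Bool
remove S v x with x ≟ v
... | yes _ = false
... | no  _ = S x

-- one leaf deletion keeping the vertex r (i.e. deleting a leaf v ≠ r
-- outside the target subtree {r}), with the induced function
DeleteLeaf : (G : Graph) → Fin (n G) → State G → State G → Set
DeleteLeaf G r (S , C) (S' , C') = ∃[ v ] ∃[ u ]
  ( v ≢ r
  × IsLeafWith G S v u
  × (∀ x → S' x ≡ remove S v x)
  × (C' u ≡ C u ℤ.+ passOn (C v))
  × (∀ x → x ≢ u → C' x ≡ C x) )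

-- c is the value at r of the induced generalized distribution on the
-- one-vertex subtree {r}, obtained via some sequence of leaf deletions
-- starting from the whole tree with function C.
InducedValue : (G : Graph) → (Fin (n G) → ℤ) → Fin (n G) → ℤ → Set
InducedValue G C r c = ∃[ S' ] ∃[ C' ]
  ( Star (DeleteLeaf G r) ((λ _ → true) , C) (S' , C')
  × (∀ x → T (S' x) → x ≡ r)
  × C' r ≡ c )

-- Both directions compare ω-solvability with the leaf-deletion process.
--
-- * Sufficiency.  Call a state (S , C) realizable if every D, ω with
--   D − ω = C on S can be moved to cover ω on S without touching the
--   vertices outside S.  A single vertex with C ≥ 0 is realizable, and
--   realizability is reflected by one leaf deletion: a leaf with surplus
--   k first sends ⌊k/2⌋ pebbles to its neighbour; a leaf with deficit m
--   is served afterwards, its neighbour having been asked for 2m more.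
--   Hence an induced value Ĉ(r) ≥ 0 makes D ω-solvable.
-- * Necessity.  A pebbling move never raises an induced value: the move
--   shifts C by −2 at its source and +1 at its target, and replaying the
--   same deletions keeps the new function below the old one up to that
--   shift, which is absorbed (through passOn) as soon as source or target
--   is deleted.  Induced values of a nonnegative function are
--   nonnegative, so a solvable D has Ĉ(r) ≥ 0 everywhere.

module Submission where

open import Defs hiding (sym)
open import Data.Nat using (ℕ)
open import Data.Fin using (Fin)
open import Data.Integer using (ℤ; _<_; +_)
open import Data.Product using (_×_; ∃-syntax)
open import Relation.Nullary using (¬_)

open import Data.Nat as ℕ using (zero; suc; _∸_; _/_; s≤s; z≤n)
import Data.Nat.Properties as ℕP
open import Data.Nat.DivMod using (/-monoˡ-≤; m/n≡1+[m∸n]/n; m/n*n≤m)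
open import Data.Integer using (-[1+_]; _+_; _-_; -_; _≤_; +≤+; -≤+; -≤-)
import Data.Integer.Properties as ℤP
open import Data.Integer.Tactic.RingSolver using (solve-∀)
open import Data.Fin using (_≟_; fromℕ<)
open import Data.Vec.Functional using (updateAt)
open import Data.Vec.Functional.Properties using (updateAt-updates; updateAt-minimal)
open import Data.Bool using (Bool; true; T)
open import Data.Unit using (tt)
open import Data.Empty using (⊥-elim)
open import Data.Product using (_,_; proj₁; proj₂)
open import Function using (_∘_)
open import Relation.Binary.Construct.Closure.ReflexiveTransitive using (Star; ε; _◅_; _◅◅_)
open import Relation.Nullary using (Dec; yes; no)
open import Relation.Binary.PropositionalEquality
  using (_≡_; _≢_; refl; sym; trans; cong; cong₂; subst; subst₂; module ≡-Reasoning)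

passOn-mono : ∀ {a b} → a ≤ b → passOn a ≤ passOn b
passOn-mono (+≤+ p) = +≤+ (/-monoˡ-≤ 2 p)
passOn-mono -≤+     = -≤+
passOn-mono (-≤- p) = -≤- (s≤s (ℕP.+-mono-≤ p p))

passOn-nonneg : ∀ {a} → + 0 ≤ a → + 0 ≤ passOn a
passOn-nonneg (+≤+ _) = +≤+ z≤n

half-suc-suc : ∀ k → suc (suc k) / 2 ≡ suc (k / 2)
half-suc-suc k = m/n≡1+[m∸n]/n {suc (suc k)} {2} (s≤s (s≤s z≤n))

-- Removing two units at a vertex lowers what it passes on by at least one;
-- this absorbs the source side of a pebbling move.
passOn-pay : ∀ a → passOn (a - + 2) + + 1 ≤ passOn a
passOn-pay (+ 0)           = -≤+
passOn-pay (+ 1)           = -≤+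
passOn-pay (+ suc (suc k)) =
  +≤+ (ℕP.≤-reflexive (trans (ℕP.+-comm (k / 2) 1) (sym (half-suc-suc k))))
passOn-pay a@(-[1+ _ ]) = begin
  ((a - + 2) + (a - + 2)) + + 1 ≡⟨ regroup a ⟩
  (a + a) - + 3                 ≤⟨ ℤP.i≤j⇒i-k≤j (+ 3) ℤP.≤-refl ⟩
  a + a                         ∎
  where
  open ℤP.≤-Reasoning
  regroup : ∀ x → ((x - + 2) + (x - + 2)) + + 1 ≡ (x + x) - + 3
  regroup = solve-∀

-- Adding one unit at a vertex raises what it passes on by at most two;
-- this absorbs the target side of a pebbling move.
passOn-gain : ∀ a → passOn (a + + 1) ≤ passOn a + + 2
passOn-gain (+ k) = +≤+ (begin
  (k ℕ.+ 1) / 2   ≤⟨ /-monoˡ-≤ 2 (ℕP.≤-reflexive (ℕP.+-comm k 1)) ⟩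
  suc k / 2       ≤⟨ /-monoˡ-≤ 2 (ℕP.n≤1+n (suc k)) ⟩
  suc (suc k) / 2 ≡⟨ half-suc-suc k ⟩
  suc (k / 2)     ≤⟨ ℕP.n≤1+n _ ⟩
  2 ℕ.+ k / 2     ≡⟨ ℕP.+-comm 2 (k / 2) ⟩
  k / 2 ℕ.+ 2     ∎)
  where open ℕP.≤-Reasoning
passOn-gain -[1+ zero ]  = ℤP.≤-refl
passOn-gain -[1+ suc k ] = ℤP.≤-reflexive (regroup (+ suc k))
  where
  regroup : ∀ s → - s + - s ≡ (- (+ 1 + s) + - (+ 1 + s)) + + 2
  regroup = solve-∀

diff-surplus : ∀ a b k → + a - + b ≡ + k → a ≡ b ℕ.+ k
diff-surplus a b k e = trans (ℤP.+-injective (begin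
  + a               ≡⟨ restore (+ a) (+ b) ⟩
  (+ a - + b) + + b ≡⟨ cong (_+ + b) e ⟩
  + (k ℕ.+ b)       ∎)) (ℕP.+-comm k b)
  where
  open ≡-Reasoning
  restore : ∀ x y → x ≡ (x - y) + y
  restore = solve-∀

diff-deficit : ∀ a b m → + a - + b ≡ -[1+ m ] → b ≡ a ℕ.+ suc m
diff-deficit a b m e = ℤP.+-injective (begin
  + b               ≡⟨ restore (+ a) (+ b) ⟩
  + a - (+ a - + b) ≡⟨ cong (λ d → + a - d) e ⟩
  + (a ℕ.+ suc m)   ∎)
  where
  open ≡-Reasoning
  restore : ∀ x y → y ≡ x - (x - y)
  restore = solve-∀

diff-covered : ∀ {a b} → + 0 ≤ + a - + b → b ℕ.≤ a
diff-covered 0≤a-b = ℤP.drop‿+≤+ (ℤP.0≤i-j⇒j≤i 0≤a-b)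

covered-diff : ∀ {a b} → b ℕ.≤ a → + 0 ≤ + a - + b
covered-diff b≤a = ℤP.i≤j⇒0≤j-i (+≤+ b≤a)

diff-add : ∀ a b q → + (a ℕ.+ q) - + b ≡ (+ a - + b) + + q
diff-add a b q = regroup (+ a) (+ b) (+ q)
  where
  regroup : ∀ x y z → (x + z) - y ≡ (x - y) + z
  regroup = solve-∀

diff-demand : ∀ a b m → + a - + (b ℕ.+ 2 ℕ.* suc m) ≡ (+ a - + b) + passOn -[1+ m ]
diff-demand a b m = regroup (+ a) (+ b) (+ suc m)
  where
  regroup : ∀ x y z → x - (y + (z + (z + + 0))) ≡ (x - y) + (- z + - z)
  regroup = solve-∀

diff-remove-two : ∀ a b → + a - + b ≡ (+ (a ℕ.+ 2) - + b) - + 2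
diff-remove-two a b = regroup (+ a) (+ b)
  where
  regroup : ∀ x y → x - y ≡ ((x + + 2) - y) - + 2
  regroup = solve-∀

module Pebbling (G : Graph) where

  V : Set
  V = Fin (n G)

  adjacent-distinct : ∀ {a b : V} → Adj G a b → a ≢ b
  adjacent-distinct a~b refl = irrefl G a~b

  outside : ∀ {S : V → Bool} {x y} → ¬ T (S x) → T (S y) → x ≢ y
  outside x∉S y∈S refl = x∉S y∈S

  remove-member : ∀ (S : V → Bool) v x → T (remove S v x) → x ≢ v × T (S x)
  remove-member S v x x∈S' with x ≟ v
  ... | no x≢v = x≢v , x∈S'

  remove-keeps : ∀ (S : V → Bool) v x → x ≢ v → T (S x) → T (remove S v x)
  remove-keeps S v x x≢v x∈S with x ≟ v
  ... | yes x≡v = ⊥-elim (x≢v x≡v)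
  ... | no _    = x∈S

  remove-drops : ∀ (S : V → Bool) v → ¬ T (remove S v v)
  remove-drops S v v∈S' with v ≟ v
  ... | no v≢v = v≢v refl

  module _ {S S' : V → Bool} {v : V} (eqS : ∀ x → S' x ≡ remove S v x) where

    survivor : ∀ {x} → T (S' x) → x ≢ v × T (S x)
    survivor {x} x∈S' = remove-member S v x (subst T (eqS x) x∈S')

    stays : ∀ {x} → x ≢ v → T (S x) → T (S' x)
    stays {x} x≢v x∈S = subst T (sym (eqS x)) (remove-keeps S v x x≢v x∈S)

    gone : ¬ T (S' v)
    gone v∈S' = remove-drops S v (subst T (eqS v) v∈S')

  Deletes : V → V → State G → State G → Set
  Deletes v u (S , C) (S' , C') =
    (∀ x → S' x ≡ remove S v x) × (C' u ≡ C u + passOn (C v)) × (∀ x → x ≢ u → C' x ≡ C x)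

  record Transfer (D : Distribution G) (a b : V) (k : ℕ) : Set where
    field
      result : Distribution G
      reach  : Reachable G D result
      source : result a ℕ.+ 2 ℕ.* k ≡ D a
      target : result b ≡ D b ℕ.+ k
      others : ∀ x → x ≢ a → x ≢ b → result x ≡ D x

  moveOne : Distribution G → V → V → Distribution G
  moveOne D a b = updateAt (updateAt D a (_∸ 2)) b suc

  module _ {D : Distribution G} {a b : V} (a~b : Adj G a b) where

    moveOne-source : 2 ℕ.≤ D a → moveOne D a b a ℕ.+ 2 ≡ D a
    moveOne-source 2≤Da = begin
      moveOne D a b a ℕ.+ 2       ≡⟨ cong (ℕ._+ 2) (updateAt-minimal a b _ (adjacent-distinct a~b)) ⟩
      updateAt D a (_∸ 2) a ℕ.+ 2 ≡⟨ cong (ℕ._+ 2) (updateAt-updates a D) ⟩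
      D a ∸ 2 ℕ.+ 2               ≡⟨ ℕP.m∸n+n≡m 2≤Da ⟩
      D a                         ∎
      where open ≡-Reasoning

    moveOne-target : moveOne D a b b ≡ D b ℕ.+ 1
    moveOne-target = begin
      moveOne D a b b             ≡⟨ updateAt-updates b _ ⟩
      suc (updateAt D a (_∸ 2) b) ≡⟨ cong suc (updateAt-minimal b a D (adjacent-distinct a~b ∘ sym)) ⟩
      suc (D b)                   ≡⟨ ℕP.+-comm 1 (D b) ⟩
      D b ℕ.+ 1                   ∎
      where open ≡-Reasoning

    moveOne-others : ∀ x → x ≢ a → x ≢ b → moveOne D a b x ≡ D x
    moveOne-others x x≢a x≢b = trans (updateAt-minimal x b _ x≢b) (updateAt-minimal x a D x≢a)

    pebblingMove : 2 ℕ.≤ D a → PebblingMove G D (moveOne D a b)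
    pebblingMove 2≤Da = a , b , a~b , 2≤Da , moveOne-source 2≤Da , moveOne-target , moveOne-others

  transfer : ∀ {a b} → Adj G a b → (D : Distribution G) (k : ℕ) → 2 ℕ.* k ℕ.≤ D a → Transfer D a b k
  transfer {a} a~b D zero _ = record
    { result = D
    ; reach  = ε
    ; source = ℕP.+-identityʳ (D a)
    ; target = sym (ℕP.+-identityʳ _)
    ; others = λ _ _ _ → refl
    }
  transfer {a} {b} a~b D (suc k) 2[1+k]≤Da = record
    { result = R.result
    ; reach  = pebblingMove a~b 2≤Da ◅ R.reach
    ; source = source
    ; target = trans R.target (trans (cong (ℕ._+ k) (moveOne-target a~b)) (ℕP.+-assoc (D b) 1 k))
    ; others = λ x x≢a x≢b → trans (R.others x x≢a x≢b) (moveOne-others a~b x x≢a x≢b)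
    }
    where
    open ≡-Reasoning
    2k+2≤Da : 2 ℕ.* k ℕ.+ 2 ℕ.≤ D a
    2k+2≤Da = subst (ℕ._≤ D a) (trans (ℕP.*-suc 2 k) (ℕP.+-comm 2 (2 ℕ.* k))) 2[1+k]≤Da
    2≤Da : 2 ℕ.≤ D a
    2≤Da = ℕP.≤-trans (ℕP.m≤n+m 2 (2 ℕ.* k)) 2k+2≤Da
    D₁ : Distribution G
    D₁ = moveOne D a b
    rest : Transfer D₁ a b k
    rest = transfer a~b D₁ k (ℕP.+-cancelʳ-≤ 2 (2 ℕ.* k) (D₁ a)
      (subst (2 ℕ.* k ℕ.+ 2 ℕ.≤_) (sym (moveOne-source a~b 2≤Da)) 2k+2≤Da))
    module R = Transfer rest
    source : R.result a ℕ.+ 2 ℕ.* suc k ≡ D a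
    source = begin
      R.result a ℕ.+ 2 ℕ.* suc k     ≡⟨ cong (R.result a ℕ.+_) (trans (ℕP.*-suc 2 k) (ℕP.+-comm 2 (2 ℕ.* k))) ⟩
      R.result a ℕ.+ (2 ℕ.* k ℕ.+ 2) ≡⟨ sym (ℕP.+-assoc (R.result a) (2 ℕ.* k) 2) ⟩
      R.result a ℕ.+ 2 ℕ.* k ℕ.+ 2   ≡⟨ cong (ℕ._+ 2) R.source ⟩
      D₁ a ℕ.+ 2                     ≡⟨ moveOne-source a~b 2≤Da ⟩
      D a                            ∎

  record Covering (S : V → Bool) (D ω : V → ℕ) : Set where
    field
      result    : Distribution G
      reach     : Reachable G D result
      covers    : ∀ x → T (S x) → ω x ℕ.≤ result x
      untouched : ∀ x → ¬ T (S x) → result x ≡ D x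

  Realizable : State G → Set
  Realizable (S , C) = ∀ (D ω : V → ℕ) → (∀ x → T (S x) → diffFun G D ω x ≡ C x) → Covering S D ω

  singleton-realizable : ∀ {S C r} → (∀ x → T (S x) → x ≡ r) → + 0 ≤ C r → Realizable (S , C)
  singleton-realizable {S} only-r 0≤Cr D ω D-ω≡C = record
    { result = D ; reach = ε ; covers = covered ; untouched = λ _ _ → refl }
    where
    covered : ∀ x → T (S x) → ω x ℕ.≤ D x
    covered x x∈S with only-r x x∈S
    ... | refl = diff-covered (subst (+ 0 ≤_) (sym (D-ω≡C x x∈S)) 0≤Cr)

  deletion-agrees : ∀ {S C S' C' v u} {D ω D₁ ω₁ : V → ℕ} → Deletes v u (S , C) (S' , C') →
    (∀ x → T (S x) → diffFun G D ω x ≡ C x) →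
    diffFun G D₁ ω₁ u ≡ diffFun G D ω u + passOn (C v) →
    (∀ x → x ≢ v → x ≢ u → diffFun G D₁ ω₁ x ≡ diffFun G D ω x) →
    ∀ x → T (S' x) → diffFun G D₁ ω₁ x ≡ C' x
  deletion-agrees {C = C} {C' = C'} {v} {u} {D} {ω} {D₁} {ω₁} (eqS , eqCu , eqCx) D-ω≡C at-u elsewhere x x∈S'
    with x ≟ u | survivor eqS x∈S'
  ... | yes refl | _ , u∈S = begin
    diffFun G D₁ ω₁ u              ≡⟨ at-u ⟩
    diffFun G D ω u + passOn (C v) ≡⟨ cong (_+ passOn (C v)) (D-ω≡C u u∈S) ⟩
    C u + passOn (C v)             ≡⟨ eqCu ⟨
    C' u                           ∎
    where open ≡-Reasoning
  ... | no x≢u | x≢v , x∈S = begin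
    diffFun G D₁ ω₁ x ≡⟨ elsewhere x x≢v x≢u ⟩
    diffFun G D ω x   ≡⟨ D-ω≡C x x∈S ⟩
    C x               ≡⟨ eqCx x x≢u ⟨
    C' x              ∎
    where open ≡-Reasoning

  -- Deleting a leaf v with surplus k: send ⌊k/2⌋ pebbles from v to u first,
  -- then solve the smaller state; v keeps at least ω v pebbles.
  reflect-surplus : ∀ {S C S' C' v u k} → IsLeafWith G S v u → Deletes v u (S , C) (S' , C') →
    C v ≡ + k → Realizable (S' , C') → Realizable (S , C)
  reflect-surplus {S} {C} {S'} {C'} {v} {u} {k} (v∈S , u∈S , v~u , _) del@(eqS , _) Cv≡k realizable′ D ω D-ω≡C =
    record { result    = Rest.result
           ; reach     = Sent.reach ◅◅ Rest.reach
           ; covers    = λ x x∈S → covered x x∈S (x ≟ v)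
           ; untouched = untouched
           }
    where
    q : ℕ
    q = k / 2
    Dv≡ωv+k : D v ≡ ω v ℕ.+ k
    Dv≡ωv+k = diff-surplus (D v) (ω v) k (trans (D-ω≡C v v∈S) Cv≡k)
    2q≤k : 2 ℕ.* q ℕ.≤ k
    2q≤k = ℕP.≤-trans (ℕP.≤-reflexive (ℕP.*-comm 2 q)) (m/n*n≤m k 2)
    sent : Transfer D v u q
    sent = transfer v~u D q (ℕP.≤-trans 2q≤k (subst (k ℕ.≤_) (sym Dv≡ωv+k) (ℕP.m≤n+m k (ω v))))
    module Sent = Transfer sent
    D₁ : Distribution G
    D₁ = Sent.result
    agrees : ∀ x → T (S' x) → diffFun G D₁ ω x ≡ C' x
    agrees = deletion-agrees {D = D} {ω} {D₁} {ω} del D-ω≡C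
      (trans (cong (λ d → + d - + ω u) Sent.target)
        (trans (diff-add (D u) (ω u) q) (cong (λ p → (+ D u - + ω u) + passOn p) (sym Cv≡k))))
      (λ x x≢v x≢u → cong (λ d → + d - + ω x) (Sent.others x x≢v x≢u))
    module Rest = Covering (realizable′ D₁ ω agrees)
    covered : ∀ x → T (S x) → Dec (x ≡ v) → ω x ℕ.≤ Rest.result x
    covered _ _ (yes refl) = subst (ω v ℕ.≤_) (sym (Rest.untouched v (gone eqS)))
      (ℕP.+-cancelʳ-≤ (2 ℕ.* q) (ω v) (D₁ v) (begin
        ω v ℕ.+ 2 ℕ.* q ≤⟨ ℕP.+-monoʳ-≤ (ω v) 2q≤k ⟩
        ω v ℕ.+ k       ≡⟨ sym Dv≡ωv+k ⟩
        D v             ≡⟨ sym Sent.source ⟩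
        D₁ v ℕ.+ 2 ℕ.* q ∎))
      where open ℕP.≤-Reasoning
    covered x x∈S (no x≢v) = Rest.covers x (stays eqS x≢v x∈S)
    untouched : ∀ x → ¬ T (S x) → Rest.result x ≡ D x
    untouched x x∉S = trans (Rest.untouched x (x∉S ∘ proj₂ ∘ survivor eqS))
      (Sent.others x (outside x∉S v∈S) (outside x∉S u∈S))

  -- Deleting a leaf v with deficit m: solve the smaller state with u's demand
  -- raised by 2m, then send m pebbles from u back to v.
  reflect-deficit : ∀ {S C S' C' v u m} → IsLeafWith G S v u → Deletes v u (S , C) (S' , C') →
    C v ≡ -[1+ m ] → Realizable (S' , C') → Realizable (S , C)
  reflect-deficit {S} {C} {S'} {C'} {v} {u} {m} (v∈S , u∈S , v~u , _) del@(eqS , _) Cv≡-m realizable′ D ω D-ω≡C =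
    record { result    = Back.result
           ; reach     = Rest.reach ◅◅ Back.reach
           ; covers    = λ x x∈S → covered x x∈S (x ≟ v) (x ≟ u)
           ; untouched = untouched
           }
    where
    demand : ℕ
    demand = 2 ℕ.* suc m
    ωv≡Dv+m : ω v ≡ D v ℕ.+ suc m
    ωv≡Dv+m = diff-deficit (D v) (ω v) m (trans (D-ω≡C v v∈S) Cv≡-m)
    ω₁ : V → ℕ
    ω₁ = updateAt ω u (ℕ._+ demand)
    agrees : ∀ x → T (S' x) → diffFun G D ω₁ x ≡ C' x
    agrees = deletion-agrees {D = D} {ω} {D} {ω₁} del D-ω≡C demand-at-u unchanged
      where
      demand-at-u : diffFun G D ω₁ u ≡ diffFun G D ω u + passOn (C v)
      demand-at-u = begin
        + D u - + ω₁ u                    ≡⟨ cong (λ o → + D u - + o) (updateAt-updates u ω) ⟩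
        + D u - + (ω u ℕ.+ demand)        ≡⟨ diff-demand (D u) (ω u) m ⟩
        (+ D u - + ω u) + passOn -[1+ m ] ≡⟨ cong (λ p → (+ D u - + ω u) + passOn p) Cv≡-m ⟨
        (+ D u - + ω u) + passOn (C v)    ∎
        where open ≡-Reasoning
      unchanged : ∀ x → x ≢ v → x ≢ u → diffFun G D ω₁ x ≡ diffFun G D ω x
      unchanged x _ x≢u = cong (λ o → + D x - + o) (updateAt-minimal x u ω x≢u)
    module Rest = Covering (realizable′ D ω₁ agrees)
    u-stocked : ω u ℕ.+ demand ℕ.≤ Rest.result u
    u-stocked = subst (ℕ._≤ Rest.result u) (updateAt-updates u ω)
      (Rest.covers u (stays eqS (adjacent-distinct v~u ∘ sym) u∈S))
    returned : Transfer Rest.result u v (suc m)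
    returned = transfer (Graph.sym G v~u) Rest.result (suc m) (ℕP.≤-trans (ℕP.m≤n+m demand (ω u)) u-stocked)
    module Back = Transfer returned
    covered : ∀ x → T (S x) → Dec (x ≡ v) → Dec (x ≡ u) → ω x ℕ.≤ Back.result x
    covered _ _ (yes refl) _ = ℕP.≤-reflexive (begin
      ω v                     ≡⟨ ωv≡Dv+m ⟩
      D v ℕ.+ suc m           ≡⟨ cong (ℕ._+ suc m) (sym (Rest.untouched v (gone eqS))) ⟩
      Rest.result v ℕ.+ suc m ≡⟨ sym Back.target ⟩
      Back.result v           ∎)
      where open ≡-Reasoning
    covered _ _ (no _) (yes refl) = ℕP.+-cancelʳ-≤ demand (ω u) (Back.result u)
      (subst (ω u ℕ.+ demand ℕ.≤_) (sym Back.source) u-stocked)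
    covered x x∈S (no x≢v) (no x≢u) = subst₂ ℕ._≤_ (updateAt-minimal x u ω x≢u) (sym (Back.others x x≢u x≢v))
      (Rest.covers x (stays eqS x≢v x∈S))
    untouched : ∀ x → ¬ T (S x) → Back.result x ≡ D x
    untouched x x∉S = trans (Back.others x (outside x∉S u∈S) (outside x∉S v∈S))
      (Rest.untouched x (x∉S ∘ proj₂ ∘ survivor eqS))

  deletion-reflects : ∀ {S C S' C' v u} → IsLeafWith G S v u → Deletes v u (S , C) (S' , C') →
    Realizable (S' , C') → Realizable (S , C)
  deletion-reflects {S} {C} {S'} {C'} {v} leaf del = by-sign (C v) refl
    where
    by-sign : ∀ c → C v ≡ c → Realizable (S' , C') → Realizable (S , C)
    by-sign (+ k)      Cv≡k  = reflect-surplus leaf del Cv≡k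
    by-sign (-[1+ m ]) Cv≡-m = reflect-deficit leaf del Cv≡-m

  deletions-reflect : ∀ {r st st'} → Star (DeleteLeaf G r) st st' → Realizable st' → Realizable st
  deletions-reflect ε                                     realizable = realizable
  deletions-reflect ((_ , _ , _ , leaf , del) ◅ deletions) realizable =
    deletion-reflects leaf del (deletions-reflect deletions realizable)

  nonneg-value⇒solvable : ∀ {D ω r c} → InducedValue G (diffFun G D ω) r c → + 0 ≤ c → Solvable G ω D
  nonneg-value⇒solvable {D} {ω} (_ , _ , deletions , only-r , Cfr≡c) 0≤c =
    Covering.result solution , Covering.reach solution , λ x → Covering.covers solution x tt
    where
    solution : Covering (λ _ → true) D ω
    solution = deletions-reflect deletions (singleton-realizable only-r (subst (+ 0 ≤_) (sym Cfr≡c) 0≤c))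
      D ω (λ _ _ → refl)

  Dominated : (V → ℤ) → State G → (V → ℤ) → Set
  Dominated δ (S , C₁) C₂ = ∀ x → T (S x) → C₂ x ≤ C₁ x + δ x

  deleteInto : V → V → (V → ℤ) → V → ℤ
  deleteInto v u C = updateAt C u (_+ passOn (C v))

  replay : ∀ {S C₁ S' C₁' v u} (C₂ : V → ℤ) → Deletes v u (S , C₁) (S' , C₁') →
    Deletes v u (S , C₂) (S' , deleteInto v u C₂)
  replay {u = u} C₂ (eqS , _ , _) = eqS , updateAt-updates u C₂ , λ x x≢u → updateAt-minimal x u C₂ x≢u

  dominated-deletion : ∀ {S C₁ S' C₁' C₂ v u} (δ δ' : V → ℤ) → Deletes v u (S , C₁) (S' , C₁') → T (S v) →
    (∀ a → passOn (a + δ v) + δ u ≤ passOn a + δ' u) → (∀ x → x ≢ v → x ≢ u → δ x ≤ δ' x) →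
    Dominated δ (S , C₁) C₂ → Dominated δ' (S' , C₁') (deleteInto v u C₂)
  dominated-deletion {_} {C₁} {_} {C₁'} {C₂} {v} {u} δ δ' (eqS , eqCu , eqCx) v∈S absorbed elsewhere dom x x∈S'
    with x ≟ u | survivor eqS x∈S'
  ... | yes refl | _ , u∈S = begin
    deleteInto v u C₂ u                 ≡⟨ updateAt-updates u C₂ ⟩
    C₂ u + passOn (C₂ v)                ≤⟨ ℤP.+-mono-≤ (dom u u∈S) (passOn-mono (dom v v∈S)) ⟩
    (C₁ u + δ u) + passOn (C₁ v + δ v)  ≡⟨ regroup (C₁ u) (δ u) (passOn (C₁ v + δ v)) ⟩
    C₁ u + (passOn (C₁ v + δ v) + δ u)  ≤⟨ ℤP.+-monoʳ-≤ (C₁ u) (absorbed (C₁ v)) ⟩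
    C₁ u + (passOn (C₁ v) + δ' u)       ≡⟨ ℤP.+-assoc (C₁ u) (passOn (C₁ v)) (δ' u) ⟨
    (C₁ u + passOn (C₁ v)) + δ' u       ≡⟨ cong (_+ δ' u) eqCu ⟨
    C₁' u + δ' u                        ∎
    where
    open ℤP.≤-Reasoning
    regroup : ∀ a b c → (a + b) + c ≡ a + (c + b)
    regroup = solve-∀
  ... | no x≢u | x≢v , x∈S = begin
    deleteInto v u C₂ x ≡⟨ updateAt-minimal x u C₂ x≢u ⟩
    C₂ x                ≤⟨ dom x x∈S ⟩
    C₁ x + δ x          ≤⟨ ℤP.+-monoʳ-≤ (C₁ x) (elsewhere x x≢v x≢u) ⟩
    C₁ x + δ' x         ≡⟨ cong (_+ δ' x) (eqCx x x≢u) ⟨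
    C₁' x + δ' x        ∎
    where open ℤP.≤-Reasoning

  -- The zero offset, and the offset by which a move u → w changes D − ω.
  noOffset : V → ℤ
  noOffset _ = + 0

  moveOffset : V → V → V → ℤ
  moveOffset u w = updateAt (updateAt noOffset w (λ _ → + 1)) u (λ _ → - + 2)

  module _ {u w : V} (u≢w : u ≢ w) where

    moveOffset-source : moveOffset u w u ≡ - + 2
    moveOffset-source = updateAt-updates u _

    moveOffset-target : moveOffset u w w ≡ + 1
    moveOffset-target = trans (updateAt-minimal w u _ (u≢w ∘ sym)) (updateAt-updates w noOffset)

    moveOffset-others : ∀ {x} → x ≢ u → x ≢ w → moveOffset u w x ≡ + 0
    moveOffset-others {x} x≢u x≢w = trans (updateAt-minimal x u _ x≢u) (updateAt-minimal x w noOffset x≢w)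

  unshifted : ∀ (δ : V → ℤ) {v u} → δ v ≡ + 0 → ∀ a → passOn (a + δ v) + δ u ≤ passOn a + δ u
  unshifted δ {_} {u} δv≡0 a =
    ℤP.≤-reflexive (cong (λ b → passOn b + δ u) (trans (cong (λ d → a + d) δv≡0) (ℤP.+-identityʳ a)))

  -- The move offset vanishes once its source or its target is deleted.
  pay-absorbed : ∀ a → passOn (a + - + 2) + + 1 ≤ passOn a + + 0
  pay-absorbed a = subst (passOn (a - + 2) + + 1 ≤_) (sym (ℤP.+-identityʳ (passOn a))) (passOn-pay a)

  gain-absorbed : ∀ a → passOn (a + + 1) + - + 2 ≤ passOn a + + 0
  gain-absorbed a = begin
    passOn (a + + 1) + - + 2       ≤⟨ ℤP.+-monoˡ-≤ (- + 2) (passOn-gain a) ⟩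
    (passOn a + + 2) + - + 2       ≡⟨ cancel (passOn a) ⟩
    passOn a + + 0                 ∎
    where
    open ℤP.≤-Reasoning
    cancel : ∀ b → (b + + 2) + - + 2 ≡ b + + 0
    cancel = solve-∀

  root-survives : ∀ {r S C Sf Cf} → Star (DeleteLeaf G r) (S , C) (Sf , Cf) → T (S r) → T (Sf r)
  root-survives ε r∈S = r∈S
  root-survives ((_ , _ , v≢r , _ , eqS , _) ◅ deletions) r∈S =
    root-survives deletions (stays eqS (v≢r ∘ sym) r∈S)

  -- Replaying the deletions of D − ω on D' − ω for a move D → D' along u → w.
  module MoveSimulation (u w : V) (u~w : Adj G u w) where

    u≢w : u ≢ w
    u≢w = adjacent-distinct u~w

    -- Either the move has been absorbed, or both of its ends are still present
    -- and the offset is still in force.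
    data Simulation (st : State G) (C₂ : V → ℤ) : Set where
      settled : Dominated noOffset st C₂ → Simulation st C₂
      pending : T (proj₁ st u) → T (proj₁ st w) → Dominated (moveOffset u w) st C₂ → Simulation st C₂

    -- One deletion preserves the simulation; deleting u or w absorbs the move.
    simulation-step : ∀ {S C₁ S' C₁' C₂ v v'} → IsLeafWith G S v v' → Deletes v v' (S , C₁) (S' , C₁') →
      Simulation (S , C₁) C₂ → Simulation (S' , C₁') (deleteInto v v' C₂)
    simulation-step {v = v} {v'} (v∈S , _) del (settled dom) =
      settled (dominated-deletion noOffset noOffset del v∈S (unshifted noOffset {v} {v'} refl) (λ _ _ _ → ℤP.≤-refl) dom)
    simulation-step {v = v} (v∈S , _ , _ , unique) del (pending u∈S w∈S dom) with v ≟ u | v ≟ w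
    ... | yes refl | _ with unique w w∈S u~w
    ... | refl = settled (dominated-deletion (moveOffset u w) noOffset del v∈S
      (λ a → subst₂ (λ s t → passOn (a + s) + t ≤ passOn a + + 0)
               (sym (moveOffset-source u≢w)) (sym (moveOffset-target u≢w)) (pay-absorbed a))
      (λ x x≢u x≢w → ℤP.≤-reflexive (moveOffset-others u≢w x≢u x≢w)) dom)
    simulation-step {v = v} (v∈S , _ , _ , unique) del (pending u∈S w∈S dom) | no v≢u | yes refl
      with unique u u∈S (Graph.sym G u~w)
    ... | refl = settled (dominated-deletion (moveOffset u w) noOffset del v∈S
      (λ a → subst₂ (λ s t → passOn (a + s) + t ≤ passOn a + + 0)
               (sym (moveOffset-target u≢w)) (sym (moveOffset-source u≢w)) (gain-absorbed a))
      (λ x x≢w x≢u → ℤP.≤-reflexive (moveOffset-others u≢w x≢u x≢w)) dom)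
    simulation-step {v = v} {v'} (v∈S , _ , _ , unique) del@(eqS , _) (pending u∈S w∈S dom) | no v≢u | no v≢w =
      pending (stays eqS (v≢u ∘ sym) u∈S) (stays eqS (v≢w ∘ sym) w∈S)
        (dominated-deletion (moveOffset u w) (moveOffset u w) del v∈S
          (unshifted (moveOffset u w) {u = v'} (moveOffset-others u≢w v≢u v≢w)) (λ _ _ _ → ℤP.≤-refl) dom)

    -- At the end only r is left, so the move is absorbed and the values compare.
    simulation-bound : ∀ {Sf Cf Cf₂ r} → (∀ x → T (Sf x) → x ≡ r) → T (Sf r) →
      Simulation (Sf , Cf) Cf₂ → Cf₂ r ≤ Cf r
    simulation-bound {Cf = Cf} {r = r} _ r∈Sf (settled dom) =
      subst (_ ≤_) (ℤP.+-identityʳ (Cf r)) (dom r r∈Sf)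
    simulation-bound only-r _ (pending u∈Sf w∈Sf _) =
      ⊥-elim (u≢w (trans (only-r u u∈Sf) (sym (only-r w w∈Sf))))

    simulate : ∀ {r S C₁ Sf Cf C₂} → Star (DeleteLeaf G r) (S , C₁) (Sf , Cf) → Simulation (S , C₁) C₂ →
      ∃[ Cf₂ ] (Star (DeleteLeaf G r) (S , C₂) (Sf , Cf₂) × Simulation (Sf , Cf) Cf₂)
    simulate ε simulation = _ , ε , simulation
    simulate {C₂ = C₂} ((v , v' , v≢r , leaf , del) ◅ deletions) simulation
      with simulate deletions (simulation-step leaf del simulation)
    ... | Cf₂ , deletions₂ , simulation-end =
      Cf₂ , (v , v' , v≢r , leaf , replay C₂ del) ◅ deletions₂ , simulation-end

    replay-below : ∀ {r S C₁ Sf Cf C₂} → Star (DeleteLeaf G r) (S , C₁) (Sf , Cf) →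
      (∀ x → T (Sf x) → x ≡ r) → T (S r) → Simulation (S , C₁) C₂ →
      ∃[ Cf₂ ] (Star (DeleteLeaf G r) (S , C₂) (Sf , Cf₂) × Cf₂ r ≤ Cf r)
    replay-below deletions only-r r∈S simulation with simulate deletions simulation
    ... | Cf₂ , deletions₂ , simulation-end =
      Cf₂ , deletions₂ , simulation-bound only-r (root-survives deletions r∈S) simulation-end

  move-shifts-diff : ∀ {D D' : Distribution G} (ω : V → ℕ) {u w} → u ≢ w → D' u ℕ.+ 2 ≡ D u →
    D' w ≡ D w ℕ.+ 1 → (∀ x → x ≢ u → x ≢ w → D' x ≡ D x) →
    ∀ x → diffFun G D' ω x ≡ diffFun G D ω x + moveOffset u w x
  move-shifts-diff {D} {D'} ω {u} {w} u≢w at-u at-w others x with x ≟ u | x ≟ w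
  ... | yes refl | _ = begin
    + D' u - + ω u                     ≡⟨ diff-remove-two (D' u) (ω u) ⟩
    (+ (D' u ℕ.+ 2) - + ω u) - + 2     ≡⟨ cong₂ (λ d o → (+ d - + ω u) + o) at-u (sym (moveOffset-source u≢w)) ⟩
    (+ D u - + ω u) + moveOffset u w u ∎
    where open ≡-Reasoning
  ... | no _ | yes refl = begin
    + D' w - + ω w                     ≡⟨ cong (λ d → + d - + ω w) at-w ⟩
    + (D w ℕ.+ 1) - + ω w              ≡⟨ diff-add (D w) (ω w) 1 ⟩
    (+ D w - + ω w) + + 1              ≡⟨ cong (λ o → (+ D w - + ω w) + o) (moveOffset-target u≢w) ⟨
    (+ D w - + ω w) + moveOffset u w w ∎
    where open ≡-Reasoning
  ... | no x≢u | no x≢w = begin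
    + D' x - + ω x                     ≡⟨ cong (λ d → + d - + ω x) (others x x≢u x≢w) ⟩
    + D x - + ω x                      ≡⟨ ℤP.+-identityʳ (+ D x - + ω x) ⟨
    (+ D x - + ω x) + + 0              ≡⟨ cong (λ o → (+ D x - + ω x) + o) (moveOffset-others u≢w x≢u x≢w) ⟨
    (+ D x - + ω x) + moveOffset u w x ∎
    where open ≡-Reasoning

  move-lowers : ∀ {D D' ω r c} → PebblingMove G D D' → InducedValue G (diffFun G D ω) r c →
    ∃[ c' ] (InducedValue G (diffFun G D' ω) r c' × c' ≤ c)
  move-lowers {D} {D'} {ω} (u , w , u~w , _ , at-u , at-w , others) (Sf , Cf , deletions , only-r , refl) =
    let open MoveSimulation u w u~w
        shifted : Dominated (moveOffset u w) ((λ _ → true) , diffFun G D ω) (diffFun G D' ω)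
        shifted = λ x _ → ℤP.≤-reflexive (move-shifts-diff ω u≢w at-u at-w others x)
        (Cf₂ , deletions₂ , Cf₂≤Cf) = replay-below deletions only-r tt (pending tt tt shifted)
    in Cf₂ _ , (Sf , Cf₂ , deletions₂ , only-r , refl) , Cf₂≤Cf

  reachable-lowers : ∀ {D D* ω r c} → Reachable G D D* → InducedValue G (diffFun G D ω) r c →
    ∃[ c* ] (InducedValue G (diffFun G D* ω) r c* × c* ≤ c)
  reachable-lowers ε induced = _ , induced , ℤP.≤-refl
  reachable-lowers {ω = ω} (move ◅ moves) induced with move-lowers {ω = ω} move induced
  ... | c₁ , induced₁ , c₁≤c with reachable-lowers {ω = ω} moves induced₁
  ... | c* , induced* , c*≤c₁ = c* , induced* , ℤP.≤-trans c*≤c₁ c₁≤c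

  Nonnegative : State G → Set
  Nonnegative (S , C) = ∀ x → T (S x) → + 0 ≤ C x

  deletion-keeps-nonneg : ∀ {S C S' C' v u} → Deletes v u (S , C) (S' , C') → T (S v) →
    Nonnegative (S , C) → Nonnegative (S' , C')
  deletion-keeps-nonneg {v = v} {u} (eqS , eqCu , eqCx) v∈S nonneg x x∈S' with x ≟ u
  ... | yes refl = subst (+ 0 ≤_) (sym eqCu)
    (ℤP.+-mono-≤ (nonneg u (proj₂ (survivor eqS x∈S'))) (passOn-nonneg (nonneg v v∈S)))
  ... | no x≢u = subst (+ 0 ≤_) (sym (eqCx x x≢u)) (nonneg x (proj₂ (survivor eqS x∈S')))

  deletions-keep-nonneg : ∀ {r st st'} → Star (DeleteLeaf G r) st st' → Nonnegative st → Nonnegative st'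
  deletions-keep-nonneg ε nonneg = nonneg
  deletions-keep-nonneg ((_ , _ , _ , (v∈S , _) , del) ◅ deletions) nonneg =
    deletions-keep-nonneg deletions (deletion-keeps-nonneg del v∈S nonneg)

  induced-nonneg : ∀ {C r c} → (∀ x → + 0 ≤ C x) → InducedValue G C r c → + 0 ≤ c
  induced-nonneg nonneg (_ , _ , deletions , _ , Cfr≡c) =
    subst (+ 0 ≤_) Cfr≡c (deletions-keep-nonneg deletions (λ x _ → nonneg x) _ (root-survives deletions tt))

  solvable⇒nonneg-value : ∀ {D ω r c} → Solvable G ω D → InducedValue G (diffFun G D ω) r c → + 0 ≤ c
  solvable⇒nonneg-value {ω = ω} (D* , reach , covers) induced with reachable-lowers {ω = ω} reach induced
  ... | c* , induced* , c*≤c = ℤP.≤-trans (induced-nonneg (λ x → covered-diff (covers x)) induced*) c*≤c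

corollary2 : (G : Graph) → IsTree G → (D : Distribution G) → (ω : Fin (n G) → ℕ) →
    ((¬ Solvable G ω D) → ∀ v c → InducedValue G (diffFun G D ω) v c → c < + 0)
    × ((∀ v → ∃[ c ] (InducedValue G (diffFun G D ω) v c × c < + 0)) → ¬ Solvable G ω D)
corollary2 G tree D ω = unsolvable⇒negative , negative⇒unsolvable
  where
  open Pebbling G
  unsolvable⇒negative : ¬ Solvable G ω D → ∀ v c → InducedValue G (diffFun G D ω) v c → c < + 0
  unsolvable⇒negative unsolvable v c induced with c ℤP.<? + 0
  ... | yes c<0 = c<0
  ... | no c≮0  = ⊥-elim (unsolvable (nonneg-value⇒solvable induced (ℤP.≮⇒≥ c≮0)))
  negative⇒unsolvable : (∀ v → ∃[ c ] (InducedValue G (diffFun G D ω) v c × c < + 0)) → ¬ Solvable G ω D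
  negative⇒unsolvable negative solvable with negative (fromℕ< (IsTree.nonempty tree))
  ... | c , induced , c<0 = ℤP.≤⇒≯ (solvable⇒nonneg-value solvable induced) c<0
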